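{- Let $G=(V,E)$ be a $4$-partite graph. Then the set of matchings $M(G)$ of $G$ is the intersection of at most three matroids on $E$.
   Context: Graphs are finite, undirected, without loops or multiple edges. A graph is $4$-partite if its vertex set can be partitioned into $4$ sets $V_1,\dots,V_4$ such that no edge has both endpoints in the same $V_i$. A matroid on a finite set $S$ is a family $\mathcal{M}$ of subsets of $S$ with $\emptyset\in\mathcal{M}$, closed under subsets, such that for every $A\subseteq S$ all maximal members of $\mathcal{M}$ contained in $A$ have the same cardinality. $M(G)$ denotes the family of all matchings of $G$ (sets of pairwise disjoint edges), as a family of subsets of $E$; the intersection of matroids $\mathcal{M}_1,\dots,\mathcal{M}_k$ on $E$ is $\mathcal{M}_1\cap\dots\cap\mathcal{M}_k$. -}

module Defs where

open import Level using (Level; suc; _⊔_)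
open import Data.Nat using (ℕ; _≤_)
open import Data.Fin using (Fin)
open import Data.Fin.Subset using (Subset; _∈_; _⊆_; ∣_∣; ⊥)
open import Data.Product using (Σ; _×_; _,_; proj₁; proj₂; ∃-syntax)
open import Data.Sum using (_⊎_)
open import Relation.Binary.PropositionalEquality using (_≡_; _≢_)
open import Relation.Nullary using (¬_)

record Graph (n m : ℕ) : Set where
  field
    end₁ end₂ : Fin m → Fin n
    noLoop : ∀ e → end₁ e ≢ end₂ e
    noMulti : ∀ e f →
      ((end₁ e ≡ end₁ f × end₂ e ≡ end₂ f) ⊎ (end₁ e ≡ end₂ f × end₂ e ≡ end₁ f)) →
      e ≡ f
open Graph public

_incident_ : ∀ {n m} (G : Graph n m) → Fin n → Fin m → Set
(G incident v) e = (end₁ G e ≡ v) ⊎ (end₂ G e ≡ v)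

FourPartite : ∀ {n m} → Graph n m → Set
FourPartite {n} G = Σ (Fin n → Fin 4) λ c → ∀ e → c (end₁ G e) ≢ c (end₂ G e)

Family : ℕ → Set₁
Family m = Subset m → Set

IsMatching : ∀ {n m} → Graph n m → Family m
IsMatching G X = ∀ e f → e ∈ X → f ∈ X → e ≢ f →
  ∀ v → ¬ ((G incident v) e × (G incident v) f)

MaximalIn : ∀ {m} → Family m → Subset m → Subset m → Set
MaximalIn 𝓜 A X = X ⊆ A × 𝓜 X × (∀ Z → X ⊆ Z → Z ⊆ A → 𝓜 Z → Z ≡ X)

record IsMatroid {m} (𝓜 : Family m) : Set where
  field
    empty : 𝓜 ⊥
    down  : ∀ X Y → Y ⊆ X → 𝓜 X → 𝓜 Y
    equi  : ∀ A X Y → MaximalIn 𝓜 A X → MaximalIn 𝓜 A Y → ∣ X ∣ ≡ ∣ Y ∣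

IsIntersectionOf : ∀ {m} → Family m → (k : ℕ) → (Fin k → Family m) → Set
IsIntersectionOf 𝓜 k 𝓜s = ∀ X → (𝓜 X → ∀ i → 𝓜s i X) × ((∀ i → 𝓜s i X) → 𝓜 X)

-- Fix, for every edge, one of its endpoints as its key.  The edge sets on which the
-- key is injective form a partition matroid, and X is a matching iff each of several
-- keys is injective on X, as soon as any two edges meeting at a vertex v are both
-- keyed to v by one of the keys.  For colour classes 0,1,2,3, the j-th key (j < 3)
-- prefers an endpoint of class j, then one of class 3: edges meeting at v are keyed
-- to v by the key j = c v if c v < 3, and otherwise by a j < 3 containing neither of
-- their other endpoints, which exists because there are only two of those.
module Submission where

open import Defs
open import Data.Nat using (ℕ; _≤_; _<_; z≤n; s≤s)
open import Data.Nat.Properties using (≤-trans; ≤-refl; ≤-antisym; _<?_; <-asym)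
open import Data.Fin using (Fin; suc; inject₁; fromℕ)
open import Data.Fin.Properties using (_≟_; all?; any?; suc-injective)
open import Data.Fin.Subset using (Subset; _∈_; _⊆_; ∣_∣; _∪_; ⁅_⁆; _-_; inside; outside)
open import Data.Fin.Subset.Properties
  using (_∈?_; ∉⊥; p⊆p∪q; x∈p∪q⁻; x∈p∪q⁺; x∈⁅x⁆; x∈⁅y⁆⇒x≡y; x∈p∧x≢y⇒x∈p-y; x∈p⇒∣p-x∣<∣p∣)
open import Data.Vec using (_∷_; []; here; there)
open import Data.Product using (Σ; _×_; _,_; ∃-syntax)
open import Data.Sum using (inj₁; inj₂)
open import Data.Empty using (⊥-elim)
open import Function using (_∘_)
open import Relation.Binary.PropositionalEquality using (_≡_; _≢_; refl; sym; trans; cong; subst)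
open import Relation.Nullary using (yes; no; contradiction)
open import Relation.Nullary.Decidable using (toWitness; ¬?; _→-dec_; _×-dec_)

InjectiveOn : ∀ {m n} → (Fin m → Fin n) → Family m
InjectiveOn key X = ∀ {e f} → e ∈ X → f ∈ X → key e ≡ key f → e ≡ f

injectiveOn-cover⇒∣∣≤ : ∀ {m k n} (g : Fin m → Fin n) (h : Fin k → Fin n) (X : Subset m) (Y : Subset k) →
  InjectiveOn g X → (∀ {e} → e ∈ X → ∃[ f ] (f ∈ Y × h f ≡ g e)) → ∣ X ∣ ≤ ∣ Y ∣
injectiveOn-cover⇒∣∣≤ g h [] Y inj cover = z≤n
injectiveOn-cover⇒∣∣≤ g h (outside ∷ X) Y inj cover =
  injectiveOn-cover⇒∣∣≤ (g ∘ suc) h X Y (λ e∈ f∈ eq → suc-injective (inj (there e∈) (there f∈) eq)) (cover ∘ there)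
injectiveOn-cover⇒∣∣≤ g h (inside ∷ X) Y inj cover with cover here
... | f₀ , f₀∈Y , hf₀ =
  ≤-trans (s≤s (injectiveOn-cover⇒∣∣≤ (g ∘ suc) h X (Y - f₀) inj′ cover′)) (x∈p⇒∣p-x∣<∣p∣ f₀∈Y)
  where
  inj′ : InjectiveOn (g ∘ suc) X
  inj′ e∈ f∈ eq = suc-injective (inj (there e∈) (there f∈) eq)
  cover′ : ∀ {e} → e ∈ X → ∃[ f ] (f ∈ Y - f₀ × h f ≡ g (suc e))
  cover′ e∈ with cover (there e∈)
  ... | f , f∈Y , hf = f , x∈p∧x≢y⇒x∈p-y f∈Y f≢f₀ , hf
    where
    f≢f₀ : f ≢ f₀
    f≢f₀ refl with inj (there e∈) here (trans (sym hf) hf₀)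
    ... | ()

module _ {m n : ℕ} (key : Fin m → Fin n) where

  injectiveOn-∪-⁅⁆ : ∀ {Y e} → InjectiveOn key Y → (∀ {f} → f ∈ Y → key f ≢ key e) →
    InjectiveOn key (Y ∪ ⁅ e ⁆)
  injectiveOn-∪-⁅⁆ {Y} {e} inj fresh a∈ b∈ eq with x∈p∪q⁻ Y ⁅ e ⁆ a∈ | x∈p∪q⁻ Y ⁅ e ⁆ b∈
  ... | inj₁ a∈Y | inj₁ b∈Y = inj a∈Y b∈Y eq
  ... | inj₁ a∈Y | inj₂ b∈e = contradiction (trans eq (cong key (x∈⁅y⁆⇒x≡y e b∈e))) (fresh a∈Y)
  ... | inj₂ a∈e | inj₁ b∈Y = contradiction (trans (sym eq) (cong key (x∈⁅y⁆⇒x≡y e a∈e))) (fresh b∈Y)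
  ... | inj₂ a∈e | inj₂ b∈e = trans (x∈⁅y⁆⇒x≡y e a∈e) (sym (x∈⁅y⁆⇒x≡y e b∈e))

  maximal-covers : ∀ {A Y e} → MaximalIn (InjectiveOn key) A Y → e ∈ A → ∃[ f ] (f ∈ Y × key f ≡ key e)
  maximal-covers {A} {Y} {e} (Y⊆A , injY , maxY) e∈A with any? (λ f → (f ∈? Y) ×-dec (key f ≟ key e))
  ... | yes found = found
  ... | no none = ⊥-elim (none (e , e∈Y , refl))
    where
    fresh : ∀ {f} → f ∈ Y → key f ≢ key e
    fresh f∈Y eq = none (_ , f∈Y , eq)
    Y∪e⊆A : Y ∪ ⁅ e ⁆ ⊆ A
    Y∪e⊆A x∈ with x∈p∪q⁻ Y ⁅ e ⁆ x∈
    ... | inj₁ x∈Y = Y⊆A x∈Y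
    ... | inj₂ x∈e = subst (_∈ A) (sym (x∈⁅y⁆⇒x≡y e x∈e)) e∈A
    e∈Y : e ∈ Y
    e∈Y = subst (e ∈_) (maxY (Y ∪ ⁅ e ⁆) (p⊆p∪q ⁅ e ⁆) Y∪e⊆A (injectiveOn-∪-⁅⁆ injY fresh))
                (x∈p∪q⁺ (inj₂ (x∈⁅x⁆ e)))

  maximal-∣∣≤ : ∀ {A X Y} → MaximalIn (InjectiveOn key) A X → MaximalIn (InjectiveOn key) A Y → ∣ X ∣ ≤ ∣ Y ∣
  maximal-∣∣≤ {X = X} {Y} (X⊆A , injX , _) maxY =
    injectiveOn-cover⇒∣∣≤ key key X Y injX (maximal-covers maxY ∘ X⊆A)

  injectiveOn-isMatroid : IsMatroid (InjectiveOn key)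
  injectiveOn-isMatroid = record
    { empty = λ e∈ → contradiction e∈ ∉⊥
    ; down  = λ X Y Y⊆X injX e∈ f∈ → injX (Y⊆X e∈) (Y⊆X f∈)
    ; equi  = λ A X Y maxX maxY → ≤-antisym (maximal-∣∣≤ maxX maxY) (maximal-∣∣≤ maxY maxX)
    }

module _ {n m : ℕ} (G : Graph n m) where

  matching-intersection : ∀ {k} (key : Fin k → Fin m → Fin n) →
    (∀ i e → (G incident key i e) e) →
    (∀ {v e f} → (G incident v) e → (G incident v) f → ∃[ i ] (key i e ≡ v × key i f ≡ v)) →
    IsIntersectionOf (IsMatching G) k (InjectiveOn ∘ key)
  matching-intersection key key-incident key-separates X = matching⇒injective , injective⇒matching
    where
    matching⇒injective : IsMatching G X → ∀ i → InjectiveOn (key i) X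
    matching⇒injective matching i {e} {f} e∈ f∈ eq with e ≟ f
    ... | yes e≡f = e≡f
    ... | no e≢f = ⊥-elim (matching e f e∈ f∈ e≢f (key i e)
                     (key-incident i e , subst (λ v → (G incident v) f) (sym eq) (key-incident i f)))
    injective⇒matching : (∀ i → InjectiveOn (key i) X) → IsMatching G X
    injective⇒matching injective e f e∈ f∈ e≢f v (v∈e , v∈f) with key-separates v∈e v∈f
    ... | i , keye , keyf = e≢f (injective i e∈ f∈ (trans keye (sym keyf)))

  opposite : ∀ {v e} → (G incident v) e → Fin n
  opposite {e = e} (inj₁ _) = end₂ G e
  opposite {e = e} (inj₂ _) = end₁ G e

  lighterEnd : (Fin n → ℕ) → Fin m → Fin n
  lighterEnd w e with w (end₂ G e) <? w (end₁ G e)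
  ... | yes _ = end₂ G e
  ... | no _  = end₁ G e

  lighterEnd-incident : ∀ w e → (G incident lighterEnd w e) e
  lighterEnd-incident w e with w (end₂ G e) <? w (end₁ G e)
  ... | yes _ = inj₂ refl
  ... | no _  = inj₁ refl

  lighterEnd-≡ : ∀ w {v e} (v∈e : (G incident v) e) → w v < w (opposite v∈e) → lighterEnd w e ≡ v
  lighterEnd-≡ w {e = e} (inj₁ refl) lighter with w (end₂ G e) <? w (end₁ G e)
  ... | yes heavier = contradiction heavier (<-asym lighter)
  ... | no _        = refl
  lighterEnd-≡ w {e = e} (inj₂ refl) lighter with w (end₂ G e) <? w (end₁ G e)
  ... | yes _       = refl
  ... | no ¬lighter = contradiction lighter ¬lighter

  opposite-colour : ∀ {k} (c : Fin n → Fin k) → (∀ e → c (end₁ G e) ≢ c (end₂ G e)) →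
    ∀ {v e} (v∈e : (G incident v) e) → c v ≢ c (opposite v∈e)
  opposite-colour c proper {e = e} (inj₁ refl) = proper e
  opposite-colour c proper {e = e} (inj₂ refl) = proper e ∘ sym

rank : Fin 3 → Fin 4 → ℕ
rank j x with x ≟ inject₁ j | x ≟ fromℕ 3
... | yes _ | _     = 0
... | no _  | yes _ = 1
... | no _  | no _  = 2

separating-rank : ∀ x a b → x ≢ a → x ≢ b → ∃[ j ] (rank j x < rank j a × rank j x < rank j b)
separating-rank = toWitness
  {a? = all? λ x → all? λ a → all? λ b → ¬? (x ≟ a) →-dec ¬? (x ≟ b) →-dec
          any? λ j → (rank j x <? rank j a) ×-dec (rank j x <? rank j b)}
  _

theorem7 : ∀ (n m : ℕ) (G : Graph n m) → FourPartite G →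
    Σ ℕ λ k → k ≤ 3 × Σ (Fin k → Family m) λ 𝓜s →
    (∀ i → IsMatroid (𝓜s i)) × IsIntersectionOf (IsMatching G) k 𝓜s
theorem7 n m G (c , proper) =
  3 , ≤-refl , InjectiveOn ∘ key , injectiveOn-isMatroid ∘ key ,
  matching-intersection G key (λ j → lighterEnd-incident G (rank j ∘ c)) keys-separate
  where
  key : Fin 3 → Fin m → Fin n
  key j = lighterEnd G (rank j ∘ c)
  keys-separate : ∀ {v e f} → (G incident v) e → (G incident v) f → ∃[ j ] (key j e ≡ v × key j f ≡ v)
  keys-separate v∈e v∈f
    with separating-rank _ _ _ (opposite-colour G c proper v∈e) (opposite-colour G c proper v∈f)
  ... | j , lighter-e , lighter-f =
    j , lighterEnd-≡ G (rank j ∘ c) v∈e lighter-e , lighterEnd-≡ G (rank j ∘ c) v∈f lighter-f
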